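{- If an Elena of size $n$ is chosen uniformly at random, the expected number of its leaves is asymptotic to $\frac{n}{\sqrt5}$ as $n\to\infty$.
   Context: Planted plane trees are rooted trees in which the children of every node are linearly ordered. An Elena is a planted plane tree of the following form: there are nodes $v_1,\dots,v_k$ ($k\ge 1$), with $v_1$ the root, such that for each $i<k$ the node $v_{i+1}$ is the rightmost child of $v_i$, the node $v_k$ is a leaf, and for each $i<k$ every other child of $v_i$ (any number $\ge0$ of them, placed to the left of $v_{i+1}$) is the top node of a path (a chain of $\ge1$ nodes each having at most one child). Equivalently, Elenas correspond to words of the language $(\mathtt{a}\,\mathtt{p}^*)^*\mathtt{a}$, with $\mathtt{a}$ a rightmost-branch node and $\mathtt{p}$ an attached path. Under the standard bijection with Dyck paths, Elenas of size $n$ correspond to nondecreasing Dyck paths (valley altitudes nondecreasing) of length $2(n-1)$. The size of an Elena is its number of nodes. -}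

module Defs where

open import Data.Nat using (ℕ; zero; suc; _+_) renaming (_*_ to _*ℕ_)
open import Data.Integer using (+_)
open import Data.List using (List; []; _∷_; _++_; map; length)
open import Data.Nat.ListAction using (sum)
open import Data.List.Relation.Unary.All using (All)
open import Data.Product using (_×_)
open import Data.Sum using (_⊎_)
open import Data.Rational.Unnormalised using (ℚᵘ; mkℚᵘ; _<_; _*_; 0ℚᵘ; 1ℚᵘ; _/_)

data Tree : Set where
  node : List Tree → Tree

mutual
  size : Tree → ℕ
  size (node ts) = suc (sizes ts)

  sizes : List Tree → ℕ
  sizes [] = 0
  sizes (t ∷ ts) = size t + sizes ts

mutual
  leaves : Tree → ℕ
  leaves (node []) = 1
  leaves (node (t ∷ ts)) = leavesL (t ∷ ts)

  leavesL : List Tree → ℕ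
  leavesL [] = 0
  leavesL (t ∷ ts) = leaves t + leavesL ts

data IsPath : Tree → Set where
  pathLeaf : IsPath (node [])
  pathStep : ∀ {t} → IsPath t → IsPath (node (t ∷ []))

-- Elena: a rightmost branch v₁ … vₖ ending in a leaf, where every other
-- child of each vᵢ (left of vᵢ₊₁) is the top node of a path.
data IsElena : Tree → Set where
  elenaLeaf : IsElena (node [])
  elenaStep : ∀ {ts t} → All IsPath ts → IsElena t → IsElena (node (ts ++ t ∷ []))

-- m / d as an unnormalised rational (0 if d = 0)
frac : ℕ → ℕ → ℚᵘ
frac m zero = 0ℚᵘ
frac m (suc d) = mkℚᵘ (+ m) d

-- Given a duplicate-free list of all Elenas of size n (uniform distribution),
-- (expected number of leaves) / n
expectedLeavesOverN : List Tree → ℕ → ℚᵘ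
expectedLeavesOverN es n = frac (sum (map leaves es)) (length es *ℕ n)

five : ℚᵘ
five = + 5 / 1

-- a < 1/√5  (Dedekind lower cut of 1/√5)
Below1/√5 : ℚᵘ → Set
Below1/√5 a = (a < 0ℚᵘ) ⊎ (five * (a * a) < 1ℚᵘ)

-- 1/√5 < b  (Dedekind upper cut of 1/√5)
Above1/√5 : ℚᵘ → Set
Above1/√5 b = (0ℚᵘ < b) × (1ℚᵘ < five * (b * b))

module Submission where

-- An Elena of size n+1 is a root whose children form a "fan": a list
-- of paths followed by an Elena.  Fans are enumerated by size together with
-- "led fans" (fans with a distinguished leftmost path), which are built either
-- by putting a new one-node path in front of a fan or by lengthening the
-- leading path; this gives explicit duplicate-free lists `elenas n` of all
-- Elenas of size n, so any enumeration is a permutation of them and the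
-- expected value is (total leaves)/(count · n) over `elenas n`.
--
-- Counting and summing leaves over these lists obeys linear recurrences whose
-- solutions are bisected Fibonacci numbers: for n = j + 3 there are
-- F = F_{2j+3} Elenas and the leaf total X satisfies 5X = n·L + 3·F_{2j+1}
-- with L = L_{2j+3} the Lucas number.  Cassini's identity L² + 4 = 5F² then
-- shows that X/(F n) is squeezed between L/(5F) and (n+3)L/(5Fn), both of
-- which tend to 1/√5; this is made effective for rational bounds a, b of the
-- Dedekind cut of 1/√5 by elementary inequalities in ℕ.

open import Defs
open import Data.Nat using (ℕ; zero; suc; _+_; _*_; _≤_; _≥_; _⊔_; s≤s; z≤n; NonZero; >-nonZero)
  renaming (_<_ to _<ℕ_)
open import Data.Nat.Properties
open import Data.Nat.Tactic.RingSolver using (solve-∀)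
open import Data.Nat.ListAction using (sum)
open import Data.Nat.ListAction.Properties using (sum-++; sum-↭)
import Data.Integer as ℤ
open import Data.Integer using (-[1+_]; +<+; -<+) renaming (_*_ to _*ℤ_; _<_ to _<ℤ_)
open import Data.Integer.Properties using (pos-*; drop‿+<+)
  renaming (*-identityˡ to *ℤ-identityˡ; *-identityʳ to *ℤ-identityʳ)
open import Data.Rational.Unnormalised using (ℚᵘ; mkℚᵘ; _<_; *<*; 0ℚᵘ; 1ℚᵘ)
  renaming (_*_ to _*ℚ_)
open import Data.List using (List; []; _∷_; _++_; map; length)
open import Data.List.Properties using (map-++; map-∘; map-cong; ∷ʳ-injective)
open import Data.List.Membership.Propositional using (_∈_)
open import Data.List.Membership.Propositional.Properties
  using (∈-map⁺; ∈-map⁻; ∈-++⁺ˡ; ∈-++⁺ʳ; ∈-++⁻)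
open import Data.List.Membership.Propositional.Properties.WithK using (unique∧set⇒bag)
open import Data.List.Relation.Binary.BagAndSetEquality using (∼bag⇒↭)
open import Data.List.Relation.Binary.Permutation.Propositional using (_↭_)
open import Data.List.Relation.Binary.Permutation.Propositional.Properties
  using (↭-length) renaming (map⁺ to ↭-map⁺)
open import Data.List.Relation.Unary.All using (All; []; _∷_)
open import Data.List.Relation.Unary.Any using (here)
import Data.List.Relation.Unary.AllPairs as AllPairs
open import Data.List.Relation.Unary.Unique.Propositional using (Unique)
import Data.List.Relation.Unary.Unique.Propositional.Properties as Unique
open import Data.Product using (_×_; _,_; ∃; proj₁)
open import Data.Sum using (inj₁; inj₂)
open import Data.Empty using (⊥-elim)
open import Function using (_∘_)
open import Function.Bundles using (_⇔_; mk⇔; Equivalence)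
open import Relation.Nullary using (¬_; yes; no)
open import Relation.Binary.PropositionalEquality

sumOf : {A : Set} → (A → ℕ) → List A → ℕ
sumOf f xs = sum (map f xs)

count : {A : Set} → List A → ℕ
count = sumOf (λ _ → 1)

count≡length : {A : Set} (xs : List A) → count xs ≡ length xs
count≡length [] = refl
count≡length (x ∷ xs) = cong suc (count≡length xs)

sumOf-++ : {A : Set} (f : A → ℕ) (xs ys : List A) →
           sumOf f (xs ++ ys) ≡ sumOf f xs + sumOf f ys
sumOf-++ f xs ys = trans (cong sum (map-++ f xs ys)) (sum-++ (map f xs) (map f ys))

sumOf-map : {A B : Set} (f : B → ℕ) (g : A → B) (xs : List A) →
            sumOf f (map g xs) ≡ sumOf (f ∘ g) xs
sumOf-map f g xs = cong sum (sym (map-∘ xs))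

sumOf-cong : {A : Set} {f g : A → ℕ} → (∀ x → f x ≡ g x) → (xs : List A) →
             sumOf f xs ≡ sumOf g xs
sumOf-cong f≗g xs = cong sum (map-cong f≗g xs)

sumOf-+ : {A : Set} (f g : A → ℕ) (xs : List A) →
          sumOf (λ x → f x + g x) xs ≡ sumOf f xs + sumOf g xs
sumOf-+ f g [] = refl
sumOf-+ f g (x ∷ xs) =
  trans (cong ((f x + g x) +_) (sumOf-+ f g xs)) (interchange (f x) (g x) _ _)
  where
  interchange : ∀ a b c d → (a + b) + (c + d) ≡ (a + c) + (b + d)
  interchange = solve-∀

-- The children of the root of an Elena: attached paths, then an Elena.
Fan : Set
Fan = List Tree × Tree

-- A fan with at least one path, whose leftmost path is singled out.
LedFan : Set
LedFan = Tree × List Tree × Tree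

root : Fan → Tree
root (ts , t) = node (ts ++ t ∷ [])

bare : Tree → Fan
bare t = [] , t

attach : LedFan → Fan
attach (p , ts , t) = p ∷ ts , t

newPath : Fan → LedFan
newPath (ts , t) = node [] , ts , t

growPath : LedFan → LedFan
growPath (p , ts , t) = node (p ∷ []) , ts , t

fanSize : Fan → ℕ
fanSize (ts , t) = sizes ts + size t

ValidFan : Fan → Set
ValidFan (ts , t) = All IsPath ts × IsElena t

ValidLedFan : LedFan → Set
ValidLedFan (p , ts , t) = IsPath p × ValidFan (ts , t)

-- The one-node Elena, listed only for size 1 (the argument is size − 1).
loneLeaf : ℕ → List Tree
loneLeaf zero = node [] ∷ []
loneLeaf (suc _) = []

-- Elenas, fans and led fans of size n (for fans: total size of the parts).
mutual
  elenas : ℕ → List Tree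
  elenas zero = []
  elenas (suc n) = loneLeaf n ++ map root (fans n)

  fans : ℕ → List Fan
  fans n = map bare (elenas n) ++ map attach (ledFans n)

  ledFans : ℕ → List LedFan
  ledFans zero = []
  ledFans (suc n) = map newPath (fans n) ++ map growPath (ledFans n)

sizes-++ : (xs ys : List Tree) → sizes (xs ++ ys) ≡ sizes xs + sizes ys
sizes-++ [] ys = refl
sizes-++ (x ∷ xs) ys = trans (cong (size x +_) (sizes-++ xs ys)) (sym (+-assoc (size x) _ _))

size-root : (x : Fan) → size (root x) ≡ suc (fanSize x)
size-root (ts , t) = cong suc (trans (sizes-++ ts (t ∷ [])) (cong (sizes ts +_) (+-identityʳ (size t))))

size-growPath : (x : LedFan) → fanSize (attach (growPath x)) ≡ suc (fanSize (attach x))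
size-growPath (p , ts , t) = cong (λ k → suc ((k + sizes ts) + size t)) (+-identityʳ (size p))

mutual
  elenas-sound : ∀ n {t} → t ∈ elenas n → IsElena t × size t ≡ n
  elenas-sound (suc n) t∈ with ∈-++⁻ (loneLeaf n) t∈
  elenas-sound (suc zero) t∈ | inj₁ (here refl) = elenaLeaf , refl
  elenas-sound (suc n) t∈ | inj₂ t∈roots with ∈-map⁻ root t∈roots
  ... | x , x∈ , refl with fans-sound n x∈
  ... | (paths , elena) , refl = elenaStep paths elena , size-root x

  fans-sound : ∀ n {x} → x ∈ fans n → ValidFan x × fanSize x ≡ n
  fans-sound n x∈ with ∈-++⁻ (map bare (elenas n)) x∈
  ... | inj₁ x∈bare with ∈-map⁻ bare x∈bare
  ...   | t , t∈ , refl with elenas-sound n t∈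
  ...     | elena , size≡ = ([] , elena) , size≡
  fans-sound n x∈ | inj₂ x∈led with ∈-map⁻ attach x∈led
  ...   | y , y∈ , refl with ledFans-sound n y∈
  ...     | (path , paths , elena) , size≡ = (path ∷ paths , elena) , size≡

  ledFans-sound : ∀ n {y} → y ∈ ledFans n → ValidLedFan y × fanSize (attach y) ≡ n
  ledFans-sound (suc n) y∈ with ∈-++⁻ (map newPath (fans n)) y∈
  ... | inj₁ y∈new with ∈-map⁻ newPath y∈new
  ...   | x , x∈ , refl with fans-sound n x∈
  ...     | (paths , elena) , size≡ = (pathLeaf , paths , elena) , cong suc size≡
  ledFans-sound (suc n) y∈ | inj₂ y∈grown with ∈-map⁻ growPath y∈grown
  ...   | z , z∈ , refl with ledFans-sound n z∈
  ...     | (path , paths , elena) , size≡ =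
    (pathStep path , paths , elena) , trans (size-growPath z) (cong suc size≡)

-- Completeness: every valid object occurs in the list of its size.  (The
-- path and Elena proofs are separate arguments so that recursion is structural.)
mutual
  elenas-complete : ∀ {t} → IsElena t → t ∈ elenas (size t)
  elenas-complete elenaLeaf = here refl
  elenas-complete (elenaStep {ts} {t} paths elena) =
    subst (λ k → root (ts , t) ∈ elenas k) (sym (size-root (ts , t)))
      (∈-++⁺ʳ (loneLeaf (fanSize (ts , t))) (∈-map⁺ root (fans-complete paths elena)))

  fans-complete : ∀ {ts t} → All IsPath ts → IsElena t → (ts , t) ∈ fans (fanSize (ts , t))
  fans-complete [] elena = ∈-++⁺ˡ (∈-map⁺ bare (elenas-complete elena))
  fans-complete {p ∷ ts} {t} (path ∷ paths) elena =
    ∈-++⁺ʳ (map bare (elenas (fanSize (p ∷ ts , t))))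
      (∈-map⁺ attach (ledFans-complete path paths elena))

  ledFans-complete : ∀ {p ts t} → IsPath p → All IsPath ts → IsElena t →
                     (p , ts , t) ∈ ledFans (fanSize (attach (p , ts , t)))
  ledFans-complete pathLeaf paths elena = ∈-++⁺ˡ (∈-map⁺ newPath (fans-complete paths elena))
  ledFans-complete {ts = ts} {t} (pathStep {p} path) paths elena =
    subst (λ k → (node (p ∷ []) , ts , t) ∈ ledFans k) (sym (size-growPath (p , ts , t)))
      (∈-++⁺ʳ (map newPath (fans (fanSize (p ∷ ts , t))))
        (∈-map⁺ growPath (ledFans-complete path paths elena)))

-- The constructors of fans and Elenas are injective and have disjoint images,
-- so the enumeration has no repetitions.
node-injective : ∀ {cs ds} → node cs ≡ node ds → cs ≡ ds
node-injective refl = refl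

root-injective : ∀ {x y} → root x ≡ root y → x ≡ y
root-injective {ts , t} {ts′ , t′} eq with ∷ʳ-injective ts ts′ (node-injective eq)
... | refl , refl = refl

bare-injective : ∀ {t t′} → bare t ≡ bare t′ → t ≡ t′
bare-injective refl = refl

attach-injective : ∀ {y z} → attach y ≡ attach z → y ≡ z
attach-injective {_ , _ , _} {_ , _ , _} refl = refl

newPath-injective : ∀ {x y} → newPath x ≡ newPath y → x ≡ y
newPath-injective {_ , _} {_ , _} refl = refl

growPath-injective : ∀ {y z} → growPath y ≡ growPath z → y ≡ z
growPath-injective {_ , _ , _} {_ , _ , _} refl = refl

leaf≢root : ∀ x → node [] ≢ root x
leaf≢root ([] , _) ()
leaf≢root (_ ∷ _ , _) ()

loneLeaf-unique : ∀ n → Unique (loneLeaf n)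
loneLeaf-unique zero = [] AllPairs.∷ AllPairs.[]
loneLeaf-unique (suc n) = AllPairs.[]

loneLeaf-disjoint : ∀ n {t} → ¬ (t ∈ loneLeaf n × t ∈ map root (fans n))
loneLeaf-disjoint zero (here refl , t∈roots) with ∈-map⁻ root t∈roots
... | x , _ , eq = leaf≢root x eq
loneLeaf-disjoint (suc n) (() , _)

mutual
  elenas-unique : ∀ n → Unique (elenas n)
  elenas-unique zero = AllPairs.[]
  elenas-unique (suc n) =
    Unique.++⁺ (loneLeaf-unique n) (Unique.map⁺ root-injective (fans-unique n)) (loneLeaf-disjoint n)

  fans-unique : ∀ n → Unique (fans n)
  fans-unique n = Unique.++⁺ (Unique.map⁺ bare-injective (elenas-unique n))
                             (Unique.map⁺ attach-injective (ledFans-unique n)) disjoint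
    where
    disjoint : ∀ {x} → ¬ (x ∈ map bare (elenas n) × x ∈ map attach (ledFans n))
    disjoint (x∈bare , x∈led) with ∈-map⁻ bare x∈bare | ∈-map⁻ attach x∈led
    ... | _ , _ , refl | _ , _ , ()

  ledFans-unique : ∀ n → Unique (ledFans n)
  ledFans-unique zero = AllPairs.[]
  ledFans-unique (suc n) = Unique.++⁺ (Unique.map⁺ newPath-injective (fans-unique n))
                                      (Unique.map⁺ growPath-injective (ledFans-unique n)) disjoint
    where
    disjoint : ∀ {y} → ¬ (y ∈ map newPath (fans n) × y ∈ map growPath (ledFans n))
    disjoint (y∈new , y∈grown) with ∈-map⁻ newPath y∈new | ∈-map⁻ growPath y∈grown
    ... | _ , _ , refl | _ , _ , ()

-- Any duplicate-free enumeration of the Elenas of size n is a permutation of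
-- `elenas n`, since duplicate-free lists with the same members are.
enumeration↭elenas : (enum : ℕ → List Tree)
  → (∀ n t → (t ∈ enum n) ⇔ (IsElena t × size t ≡ n))
  → (∀ n → Unique (enum n)) → ∀ n → enum n ↭ elenas n
enumeration↭elenas enum spec unique n =
  ∼bag⇒↭ (unique∧set⇒bag (unique n) (elenas-unique n) (λ {t} → mk⇔ (to t) (from t)))
  where
  to : ∀ t → t ∈ enum n → t ∈ elenas n
  to t t∈ with Equivalence.to (spec n t) t∈
  ... | elena , refl = elenas-complete elena
  from : ∀ t → t ∈ elenas n → t ∈ enum n
  from t t∈ = Equivalence.from (spec n t) (elenas-sound n t∈)

-- #E n = number of Elenas of size n, ΛE n = their total number of leaves;
-- #F, ΛF and #L, ΛL are the analogues for fans and led fans, where the leaves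
-- of a fan are those of the Elena it is the root fan of.
fanLeaves : Fan → ℕ
fanLeaves (ts , t) = leavesL ts + leaves t

#E ΛE #F ΛF #L ΛL : ℕ → ℕ
#E n = count (elenas n)
ΛE n = sumOf leaves (elenas n)
#F n = count (fans n)
ΛF n = sumOf fanLeaves (fans n)
#L n = count (ledFans n)
ΛL n = sumOf (fanLeaves ∘ attach) (ledFans n)

expected≡ratio : (enum : ℕ → List Tree)
  → (∀ n t → (t ∈ enum n) ⇔ (IsElena t × size t ≡ n))
  → (∀ n → Unique (enum n))
  → ∀ n → expectedLeavesOverN (enum n) n ≡ frac (ΛE n) (#E n * n)
expected≡ratio enum spec unique n =
  cong₂ frac (sum-↭ (↭-map⁺ leaves perm))
             (cong (_* n) (trans (↭-length perm) (sym (count≡length (elenas n)))))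
  where
  perm : enum n ↭ elenas n
  perm = enumeration↭elenas enum spec unique n

sumOf-elenas : (f : Tree → ℕ) (n : ℕ) → sumOf f (elenas (2 + n)) ≡ sumOf (f ∘ root) (fans (1 + n))
sumOf-elenas f n = sumOf-map f root (fans (1 + n))

sumOf-fans : (f : Fan → ℕ) (n : ℕ) →
             sumOf f (fans n) ≡ sumOf (f ∘ bare) (elenas n) + sumOf (f ∘ attach) (ledFans n)
sumOf-fans f n = trans (sumOf-++ f (map bare (elenas n)) _)
                       (cong₂ _+_ (sumOf-map f bare (elenas n)) (sumOf-map f attach (ledFans n)))

sumOf-ledFans : (f : LedFan → ℕ) (n : ℕ) →
  sumOf f (ledFans (1 + n)) ≡ sumOf (f ∘ newPath) (fans n) + sumOf (f ∘ growPath) (ledFans n)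
sumOf-ledFans f n = trans (sumOf-++ f (map newPath (fans n)) _)
                          (cong₂ _+_ (sumOf-map f newPath (fans n)) (sumOf-map f growPath (ledFans n)))

leavesL-++ : (xs ys : List Tree) → leavesL (xs ++ ys) ≡ leavesL xs + leavesL ys
leavesL-++ [] ys = refl
leavesL-++ (x ∷ xs) ys = trans (cong (leaves x +_) (leavesL-++ xs ys)) (sym (+-assoc (leaves x) _ _))

leaves-root : (x : Fan) → leaves (root x) ≡ fanLeaves x
leaves-root ([] , t) = +-identityʳ (leaves t)
leaves-root (p ∷ ts , t) =
  trans (leavesL-++ (p ∷ ts) (t ∷ [])) (cong (leavesL (p ∷ ts) +_) (+-identityʳ (leaves t)))

leaves-growPath : (y : LedFan) → fanLeaves (attach (growPath y)) ≡ fanLeaves (attach y)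
leaves-growPath (p , ts , t) = cong (λ k → (k + leavesL ts) + leaves t) (+-identityʳ (leaves p))

#E-step : ∀ n → #E (2 + n) ≡ #F (1 + n)
#E-step = sumOf-elenas (λ _ → 1)

#F-split : ∀ n → #F n ≡ #E n + #L n
#F-split = sumOf-fans (λ _ → 1)

#L-step : ∀ n → #L (1 + n) ≡ #F n + #L n
#L-step = sumOf-ledFans (λ _ → 1)

ΛE-step : ∀ n → ΛE (2 + n) ≡ ΛF (1 + n)
ΛE-step n = trans (sumOf-elenas leaves n) (sumOf-cong leaves-root (fans (1 + n)))

ΛF-split : ∀ n → ΛF n ≡ ΛE n + ΛL n
ΛF-split = sumOf-fans fanLeaves

-- A new one-node path adds one leaf to every fan.
ΛL-step : ∀ n → ΛL (1 + n) ≡ (#F n + ΛF n) + ΛL n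
ΛL-step n = trans (sumOf-ledFans (fanLeaves ∘ attach) n)
  (cong₂ _+_ (sumOf-+ (λ _ → 1) fanLeaves (fans n)) (sumOf-cong leaves-growPath (ledFans n)))

-- evenFib j = F_{2j} and oddFib j = F_{2j+1}.
mutual
  evenFib : ℕ → ℕ
  evenFib zero = 0
  evenFib (suc j) = evenFib j + oddFib j

  oddFib : ℕ → ℕ
  oddFib zero = 1
  oddFib (suc j) = evenFib j + 2 * oddFib j

-- The Lucas number L_{2j+1} = F_{2j} + F_{2j+2}.
oddLucas : ℕ → ℕ
oddLucas j = 2 * evenFib j + oddFib j

-- F_{2j+1} grows at least linearly; this forces n ≤ L below.
oddFib-growth : ∀ j → suc j ≤ oddFib j
oddFib-growth zero = s≤s z≤n
oddFib-growth (suc j) = begin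
  2 + j                     ≤⟨ s≤s (oddFib-growth j) ⟩
  1 + u                     ≤⟨ +-monoˡ-≤ u (≤-trans (s≤s z≤n) (oddFib-growth j)) ⟩
  u + u                     ≡⟨ cong (u +_) (sym (+-identityʳ u)) ⟩
  2 * u                     ≤⟨ m≤n+m (2 * u) (evenFib j) ⟩
  evenFib j + 2 * oddFib j  ∎
  where
  open ≤-Reasoning
  u : ℕ
  u = oddFib j

fib-cassini : ∀ j → oddFib j * oddFib j ≡ evenFib j * evenFib j + evenFib j * oddFib j + 1
fib-cassini zero = refl
fib-cassini (suc j) = begin
  (w + 2 * u) * (w + 2 * u)                         ≡⟨ expand w u ⟩
  w * w + 4 * (w * u) + 3 * (u * u) + u * u         ≡⟨ cong (w * w + 4 * (w * u) + 3 * (u * u) +_) (fib-cassini j) ⟩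
  w * w + 4 * (w * u) + 3 * (u * u) + (w * w + w * u + 1)  ≡⟨ regroup w u ⟩
  (w + u) * (w + u) + (w + u) * (w + 2 * u) + 1     ∎
  where
  open ≡-Reasoning
  w u : ℕ
  w = evenFib j
  u = oddFib j
  expand : ∀ w u → (w + 2 * u) * (w + 2 * u) ≡ w * w + 4 * (w * u) + 3 * (u * u) + u * u
  expand = solve-∀
  regroup : ∀ w u → w * w + 4 * (w * u) + 3 * (u * u) + (w * w + w * u + 1)
                  ≡ (w + u) * (w + u) + (w + u) * (w + 2 * u) + 1
  regroup = solve-∀

lucas-cassini : ∀ j → oddLucas j * oddLucas j + 4 ≡ 5 * (oddFib j * oddFib j)
lucas-cassini j = begin
  (2 * w + u) * (2 * w + u) + 4     ≡⟨ expand w u ⟩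
  4 * (w * w + w * u + 1) + u * u   ≡⟨ cong (λ z → 4 * z + u * u) (sym (fib-cassini j)) ⟩
  4 * (u * u) + u * u               ≡⟨ collect (u * u) ⟩
  5 * (u * u)                       ∎
  where
  open ≡-Reasoning
  w u : ℕ
  w = evenFib j
  u = oddFib j
  expand : ∀ w u → (2 * w + u) * (2 * w + u) + 4 ≡ 4 * (w * w + w * u + 1) + u * u
  expand = solve-∀
  collect : ∀ s → 4 * s + s ≡ 5 * s
  collect = solve-∀

fan-counts : ∀ j → #F (1 + j) ≡ oddFib j × #L (1 + j) ≡ evenFib j
fan-counts zero = refl , refl
fan-counts (suc j) with fan-counts j
... | fans≡ , led≡ = fans′≡ , led′≡
  where
  led′≡ : #L (2 + j) ≡ evenFib (suc j)
  led′≡ = trans (#L-step (1 + j)) (trans (cong₂ _+_ fans≡ led≡) (+-comm (oddFib j) (evenFib j)))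
  fans′≡ : #F (2 + j) ≡ oddFib (suc j)
  fans′≡ = begin
    #F (2 + j)                              ≡⟨ #F-split (2 + j) ⟩
    #E (2 + j) + #L (2 + j)                 ≡⟨ cong₂ _+_ (trans (#E-step j) fans≡) led′≡ ⟩
    oddFib j + (evenFib j + oddFib j)       ≡⟨ regroup (evenFib j) (oddFib j) ⟩
    evenFib j + 2 * oddFib j                ∎
    where
    open ≡-Reasoning
    regroup : ∀ w u → u + (w + u) ≡ w + 2 * u
    regroup = solve-∀

fanLeafForm ledLeafForm : ℕ → ℕ
fanLeafForm j = (3 + j) * (3 * evenFib j + 4 * oddFib j) + 3 * oddFib j
ledLeafForm j = (2 + j) * (evenFib j + 3 * oddFib j) + (3 * evenFib j + 4 * oddFib j) + 3 * evenFib j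

-- The leaf totals are tracked multiplied by 5 to stay in ℕ.
five-distrib : ∀ a b → 5 * (a + b) ≡ 5 * a + 5 * b
five-distrib = *-distribˡ-+ 5

leaf-totals : ∀ j → 5 * ΛF (2 + j) ≡ fanLeafForm j × 5 * ΛL (2 + j) ≡ ledLeafForm j
leaf-totals zero = refl , refl
leaf-totals (suc j) with leaf-totals j
... | fans≡ , led≡ = fans′≡ , led′≡
  where
  open ≡-Reasoning
  w u : ℕ
  w = evenFib j
  u = oddFib j
  led′≡ : 5 * ΛL (3 + j) ≡ ledLeafForm (suc j)
  led′≡ = begin
    5 * ΛL (3 + j)                                    ≡⟨ cong (5 *_) (ΛL-step (2 + j)) ⟩
    5 * ((#F (2 + j) + ΛF (2 + j)) + ΛL (2 + j))      ≡⟨ five-distrib (#F (2 + j) + ΛF (2 + j)) (ΛL (2 + j)) ⟩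
    5 * (#F (2 + j) + ΛF (2 + j)) + 5 * ΛL (2 + j)    ≡⟨ cong (_+ 5 * ΛL (2 + j)) (five-distrib (#F (2 + j)) (ΛF (2 + j))) ⟩
    (5 * #F (2 + j) + 5 * ΛF (2 + j)) + 5 * ΛL (2 + j)
      ≡⟨ cong₂ _+_ (cong₂ _+_ (cong (5 *_) (proj₁ (fan-counts (suc j)))) fans≡) led≡ ⟩
    (5 * oddFib (suc j) + fanLeafForm j) + ledLeafForm j  ≡⟨ step j w u ⟩
    ledLeafForm (suc j)                               ∎
    where
    step : ∀ j w u →
      (5 * (w + 2 * u) + ((3 + j) * (3 * w + 4 * u) + 3 * u))
        + ((2 + j) * (w + 3 * u) + (3 * w + 4 * u) + 3 * w)
      ≡ (3 + j) * ((w + u) + 3 * (w + 2 * u)) + (3 * (w + u) + 4 * (w + 2 * u)) + 3 * (w + u)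
    step = solve-∀
  fans′≡ : 5 * ΛF (3 + j) ≡ fanLeafForm (suc j)
  fans′≡ = begin
    5 * ΛF (3 + j)                   ≡⟨ cong (5 *_) (trans (ΛF-split (3 + j)) (cong (_+ ΛL (3 + j)) (ΛE-step (1 + j)))) ⟩
    5 * (ΛF (2 + j) + ΛL (3 + j))    ≡⟨ five-distrib (ΛF (2 + j)) (ΛL (3 + j)) ⟩
    5 * ΛF (2 + j) + 5 * ΛL (3 + j)  ≡⟨ cong₂ _+_ fans≡ led′≡ ⟩
    fanLeafForm j + ledLeafForm (suc j)  ≡⟨ step j w u ⟩
    fanLeafForm (suc j)              ∎
    where
    step : ∀ j w u →
      ((3 + j) * (3 * w + 4 * u) + 3 * u)
        + ((3 + j) * ((w + u) + 3 * (w + 2 * u)) + (3 * (w + u) + 4 * (w + 2 * u)) + 3 * (w + u))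
      ≡ (3 + suc j) * (3 * (w + u) + 4 * (w + 2 * u)) + 3 * (w + 2 * u)
    step = solve-∀

-- X/(F n) lies between L/(5F) and (n+3)L/(5Fn) with L² + 4 = 5F² and n ≤ L;
-- both bounds tend to 1/√5.
record NearRatio (X F n : ℕ) : Set where
  field
    L       : ℕ
    cassini : L * L + 4 ≡ 5 * (F * F)
    F≤L     : F ≤ L
    n≤L     : n ≤ L
    lower   : n * L ≤ 5 * X
    upper   : 5 * X ≤ n * L + 3 * L

-- Cassini's identity rules out F = 0.
NearRatio-F-positive : ∀ {X F n} → NearRatio X F n → 1 ≤ F
NearRatio-F-positive {F = zero} near with m+n≡0⇒n≡0 (NearRatio.L near * NearRatio.L near) (NearRatio.cassini near)
... | ()
NearRatio-F-positive {F = suc _} _ = s≤s z≤n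

square-cancel-< : ∀ a b → a * a <ℕ b * b → a <ℕ b
square-cancel-< a b a²<b² with a <? b
... | yes a<b = a<b
... | no a≮b = ⊥-elim (<-irrefl refl (<-≤-trans a²<b² (*-mono-≤ b≤a b≤a)))
  where
  b≤a : b ≤ a
  b≤a = ≮⇒≥ a≮b

below-lucas-ratio : ∀ {P Q F L} → L * L + 4 ≡ 5 * (F * F) → 5 * (P * P) <ℕ Q * Q → 5 * P <ℕ L →
                    5 * P * F <ℕ L * Q
below-lucas-ratio {P} {Q} {F} {L} cassini 5P²<Q² 5P<L = square-cancel-< _ _ (begin-strict
  (5 * P * F) * (5 * P * F)                ≡⟨ square-product P F ⟩
  (5 * (P * P)) * (5 * (F * F))            ≡⟨ cong ((5 * (P * P)) *_) (sym cassini) ⟩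
  (5 * (P * P)) * (L * L + 4)              ≡⟨ distribute P (L * L) ⟩
  (5 * (P * P)) * (L * L) + 20 * (P * P)   <⟨ +-monoʳ-< ((5 * (P * P)) * (L * L)) 20P²<L² ⟩
  (5 * (P * P)) * (L * L) + L * L          ≡⟨ absorb (5 * (P * P)) (L * L) ⟩
  (L * L) * suc (5 * (P * P))              ≤⟨ *-monoʳ-≤ (L * L) 5P²<Q² ⟩
  (L * L) * (Q * Q)                        ≡⟨ square-product′ L Q ⟩
  (L * Q) * (L * Q)                        ∎)
  where
  open ≤-Reasoning
  square-product : ∀ P F → (5 * P * F) * (5 * P * F) ≡ (5 * (P * P)) * (5 * (F * F))
  square-product = solve-∀
  distribute : ∀ P b → (5 * (P * P)) * (b + 4) ≡ (5 * (P * P)) * b + 20 * (P * P)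
  distribute = solve-∀
  absorb : ∀ a b → a * b + b ≡ b * suc a
  absorb = solve-∀
  square-product′ : ∀ L Q → (L * L) * (Q * Q) ≡ (L * Q) * (L * Q)
  square-product′ = solve-∀
  20P²<L² : 20 * (P * P) <ℕ L * L
  20P²<L² = begin-strict
    20 * (P * P)                          <⟨ s≤s (m≤m+n _ _) ⟩
    suc (20 * (P * P) + (5 * (P * P) + 10 * P)) ≡⟨ square-succ P ⟩
    suc (5 * P) * suc (5 * P)             ≤⟨ *-mono-≤ 5P<L 5P<L ⟩
    L * L                                 ∎
    where
    square-succ : ∀ P → suc (20 * (P * P) + (5 * (P * P) + 10 * P)) ≡ suc (5 * P) * suc (5 * P)
    square-succ = solve-∀

below-ratio : ∀ {X F n P Q} → NearRatio X F n → 5 * (P * P) <ℕ Q * Q → 5 * P <ℕ n →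
              P * (F * n) <ℕ X * Q
below-ratio {X} {F} {n@(suc _)} {P} {Q} near 5P²<Q² 5P<n = *-cancelˡ-< 5 _ _ (begin-strict
  5 * (P * (F * n))   ≡⟨ rearrange P F n ⟩
  n * (5 * P * F)     <⟨ *-monoʳ-< n (below-lucas-ratio {P} {Q} {F} {L} cassini 5P²<Q² (<-≤-trans 5P<n n≤L)) ⟩
  n * (L * Q)         ≡⟨ sym (*-assoc n L Q) ⟩
  n * L * Q           ≤⟨ *-monoˡ-≤ Q lower ⟩
  5 * X * Q           ≡⟨ *-assoc 5 X Q ⟩
  5 * (X * Q)         ∎)
  where
  open NearRatio near
  open ≤-Reasoning
  rearrange : ∀ P F n → 5 * (P * (F * n)) ≡ n * (5 * P * F)
  rearrange = solve-∀

above-lucas-gap : ∀ {P Q F L} → L * L + 4 ≡ 5 * (F * F) → Q * Q <ℕ 5 * (P * P) →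
                  (L * Q) * (L * Q) + L * L ≤ (5 * P * F) * (5 * P * F)
above-lucas-gap {P} {Q} {F} {L} cassini Q²<5P² = begin
  (L * Q) * (L * Q) + L * L                  ≡⟨ factor L Q ⟩
  (L * L) * suc (Q * Q)                      ≤⟨ *-monoʳ-≤ (L * L) Q²<5P² ⟩
  (L * L) * (5 * (P * P))                    ≤⟨ m≤m+n _ (20 * (P * P)) ⟩
  (L * L) * (5 * (P * P)) + 20 * (P * P)     ≡⟨ distribute P (L * L) ⟩
  (5 * (P * P)) * (L * L + 4)                ≡⟨ cong ((5 * (P * P)) *_) cassini ⟩
  (5 * (P * P)) * (5 * (F * F))              ≡⟨ square-product P F ⟩
  (5 * P * F) * (5 * P * F)                  ∎
  where
  open ≤-Reasoning
  factor : ∀ L Q → (L * Q) * (L * Q) + L * L ≡ (L * L) * suc (Q * Q)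
  factor = solve-∀
  distribute : ∀ P b → b * (5 * (P * P)) + 20 * (P * P) ≡ (5 * (P * P)) * (b + 4)
  distribute = solve-∀
  square-product : ∀ P F → (5 * (P * P)) * (5 * (F * F)) ≡ (5 * P * F) * (5 * P * F)
  square-product = solve-∀

-- With A = 5PF and
-- B = LQ this is (n + 3)B < nA, obtained after multiplying by A + B from the
-- gap A² ≥ B² + L² and 3B(A + B) ≤ 3Q(5P + Q)L².
above-ratio : ∀ {X F n P Q} → NearRatio X F n → Q * Q <ℕ 5 * (P * P) → 3 * Q * (5 * P + Q) <ℕ n →
              X * Q <ℕ P * (F * n)
above-ratio {X} {F} {n} {P} {Q} near Q²<5P² K<n = *-cancelˡ-< 5 _ _ (begin-strict
  5 * (X * Q)           ≡⟨ sym (*-assoc 5 X Q) ⟩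
  5 * X * Q             ≤⟨ *-monoˡ-≤ Q upper ⟩
  (n * L + 3 * L) * Q   ≡⟨ expand n L Q ⟩
  n * B + 3 * B         <⟨ *-cancelʳ-< (A + B) (n * B + 3 * B) (n * A) scaled ⟩
  n * A                 ≡⟨ rearrange n P F ⟩
  5 * (P * (F * n))     ∎)
  where
  open NearRatio near
  open ≤-Reasoning
  A B K : ℕ
  A = 5 * P * F
  B = L * Q
  K = 3 * Q * (5 * P + Q)
  instance
    L²-nonZero : NonZero (L * L)
    L²-nonZero = >-nonZero (*-mono-≤ L-pos L-pos)
      where
      L-pos : 1 ≤ L
      L-pos = ≤-trans (s≤s z≤n) (≤-trans K<n n≤L)
  error-term : 3 * B * (A + B) ≤ K * (L * L)
  error-term = begin
    3 * B * (A + B)                  ≤⟨ *-monoʳ-≤ (3 * B) (+-monoˡ-≤ B (*-monoʳ-≤ (5 * P) F≤L)) ⟩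
    3 * B * (5 * P * L + B)          ≡⟨ factor P Q L ⟩
    K * (L * L)                      ∎
    where
    factor : ∀ P Q L → 3 * (L * Q) * (5 * P * L + L * Q) ≡ 3 * Q * (5 * P + Q) * (L * L)
    factor = solve-∀
  scaled : (n * B + 3 * B) * (A + B) <ℕ (n * A) * (A + B)
  scaled = begin-strict
    (n * B + 3 * B) * (A + B)               ≡⟨ split n A B ⟩
    n * (B * B + A * B) + 3 * B * (A + B)   ≤⟨ +-monoʳ-≤ (n * (B * B + A * B)) error-term ⟩
    n * (B * B + A * B) + K * (L * L)       <⟨ +-monoʳ-< (n * (B * B + A * B)) (*-monoˡ-< (L * L) K<n) ⟩
    n * (B * B + A * B) + n * (L * L)       ≡⟨ regroup n A B (L * L) ⟩
    n * ((B * B + L * L) + A * B)           ≤⟨ *-monoʳ-≤ n (+-monoˡ-≤ (A * B) (above-lucas-gap {P} {Q} {F} {L} cassini Q²<5P²)) ⟩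
    n * (A * A + A * B)                     ≡⟨ factor n A B ⟩
    (n * A) * (A + B)                       ∎
    where
    split : ∀ n A B → (n * B + 3 * B) * (A + B) ≡ n * (B * B + A * B) + 3 * B * (A + B)
    split = solve-∀
    regroup : ∀ n A B l → n * (B * B + A * B) + n * l ≡ n * ((B * B + l) + A * B)
    regroup = solve-∀
    factor : ∀ n A B → n * (A * A + A * B) ≡ (n * A) * (A + B)
    factor = solve-∀
  expand : ∀ n L Q → (n * L + 3 * L) * Q ≡ n * (L * Q) + 3 * (L * Q)
  expand = solve-∀
  rearrange : ∀ n P F → n * (5 * P * F) ≡ 5 * (P * (F * n))
  rearrange = solve-∀

-- L_{2j+3} = 3 F_{2j} + 4 F_{2j+1}, the form in which the leaf totals arise.
oddLucas-suc : ∀ j → oddLucas (suc j) ≡ 3 * evenFib j + 4 * oddFib j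
oddLucas-suc j = unfold (evenFib j) (oddFib j)
  where
  unfold : ∀ w u → 2 * (w + u) + (w + 2 * u) ≡ 3 * w + 4 * u
  unfold = solve-∀

elenas-count : ∀ j → #E (3 + j) ≡ oddFib (suc j)
elenas-count j = trans (#E-step (1 + j)) (proj₁ (fan-counts (suc j)))

elenas-leaves : ∀ j → 5 * ΛE (3 + j) ≡ (3 + j) * oddLucas (suc j) + 3 * oddFib j
elenas-leaves j = begin
  5 * ΛE (3 + j)                                       ≡⟨ cong (5 *_) (ΛE-step (1 + j)) ⟩
  5 * ΛF (2 + j)                                       ≡⟨ proj₁ (leaf-totals j) ⟩
  (3 + j) * (3 * evenFib j + 4 * oddFib j) + 3 * oddFib j ≡⟨ cong (λ L → (3 + j) * L + 3 * oddFib j) (sym (oddLucas-suc j)) ⟩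
  (3 + j) * oddLucas (suc j) + 3 * oddFib j            ∎
  where open ≡-Reasoning

elenas-nearRatio : ∀ n → 3 ≤ n → NearRatio (ΛE n) (#E n) n
elenas-nearRatio (suc (suc (suc j))) (s≤s (s≤s (s≤s z≤n))) =
  subst (λ F → NearRatio (ΛE (3 + j)) F (3 + j)) (sym (elenas-count j)) (record
    { L       = L
    ; cassini = lucas-cassini (suc j)
    ; F≤L     = m≤n+m (oddFib (suc j)) (2 * evenFib (suc j))
    ; n≤L     = n≤L
    ; lower   = ≤-trans (m≤m+n ((3 + j) * L) (3 * u)) (≤-reflexive (sym (elenas-leaves j)))
    ; upper   = ≤-trans (≤-reflexive (elenas-leaves j)) (+-monoʳ-≤ ((3 + j) * L) (*-monoʳ-≤ 3 u≤L))
    })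
  where
  open ≤-Reasoning
  w u : ℕ
  w = evenFib j
  u = oddFib j
  L : ℕ
  L = oddLucas (suc j)
  u≤L : u ≤ L
  u≤L = begin
    u              ≤⟨ m≤n*m u 4 ⟩
    4 * u          ≤⟨ m≤n+m (4 * u) (3 * w) ⟩
    3 * w + 4 * u  ≡⟨ sym (oddLucas-suc j) ⟩
    L              ∎
  n≤L : 3 + j ≤ L
  n≤L = begin
    3 + j                  ≤⟨ m≤m+n (3 + j) (1 + 3 * j) ⟩
    (3 + j) + (1 + 3 * j)  ≡⟨ four-times-suc j ⟩
    4 * suc j              ≤⟨ *-monoʳ-≤ 4 (oddFib-growth j) ⟩
    4 * u                  ≤⟨ m≤n+m (4 * u) (3 * w) ⟩
    3 * w + 4 * u          ≡⟨ sym (oddLucas-suc j) ⟩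
    L                      ∎
    where
    four-times-suc : ∀ j → (3 + j) + (1 + 3 * j) ≡ 4 * suc j
    four-times-suc = solve-∀

frac-above : ∀ P dm X Y → 1 ≤ Y → P * Y <ℕ X * suc dm → mkℚᵘ (ℤ.+ P) dm < frac X Y
frac-above P dm X (suc d) _ h = *<* (subst₂ _<ℤ_ (pos-* P (suc d)) (pos-* X (suc dm)) (+<+ h))

frac-below : ∀ P dm X Y → 1 ≤ Y → X * suc dm <ℕ P * Y → frac X Y < mkℚᵘ (ℤ.+ P) dm
frac-below P dm X (suc d) _ h = *<* (subst₂ _<ℤ_ (pos-* X (suc dm)) (pos-* P (suc d)) (+<+ h))

negative-below-frac : ∀ m dm X Y → 1 ≤ Y → mkℚᵘ -[1+ m ] dm < frac X Y
negative-below-frac m dm X (suc d) _ =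
  *<* (subst (λ z → -[1+ m ] *ℤ ℤ.+ suc d <ℤ z) (pos-* X (suc dm)) -<+)

nonnegative-not-negative : ∀ P dm → ¬ (mkℚᵘ (ℤ.+ P) dm < 0ℚᵘ)
nonnegative-not-negative P dm (*<* h) with drop‿+<+ (subst₂ _<ℤ_ (sym (pos-* P 1)) refl h)
... | ()

negative-not-positive : ∀ m dm → ¬ (0ℚᵘ < mkℚᵘ -[1+ m ] dm)
negative-not-positive m dm (*<* ())

five-square-numerator : ∀ P → (ℤ.+ 5 *ℤ (ℤ.+ P *ℤ ℤ.+ P)) *ℤ ℤ.+ 1 ≡ ℤ.+ (5 * (P * P))
five-square-numerator P =
  trans (*ℤ-identityʳ _) (trans (cong (ℤ.+ 5 *ℤ_) (sym (pos-* P P))) (sym (pos-* 5 (P * P))))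

square-denominator : ∀ dm → ℤ.+ 1 *ℤ ℤ.+ (1 * (suc dm * suc dm)) ≡ ℤ.+ (suc dm * suc dm)
square-denominator dm = trans (*ℤ-identityˡ _) (cong ℤ.+_ (*-identityˡ (suc dm * suc dm)))

below-cut-square : ∀ P dm → five *ℚ (mkℚᵘ (ℤ.+ P) dm *ℚ mkℚᵘ (ℤ.+ P) dm) < 1ℚᵘ →
                   5 * (P * P) <ℕ suc dm * suc dm
below-cut-square P dm (*<* h) =
  drop‿+<+ (subst₂ _<ℤ_ (five-square-numerator P) (square-denominator dm) h)

above-cut-square : ∀ P dm → 1ℚᵘ < five *ℚ (mkℚᵘ (ℤ.+ P) dm *ℚ mkℚᵘ (ℤ.+ P) dm) →
                   suc dm * suc dm <ℕ 5 * (P * P)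
above-cut-square P dm (*<* h) =
  drop‿+<+ (subst₂ _<ℤ_ (square-denominator dm) (five-square-numerator P) h)

positive-denominator : ∀ {X F n} → NearRatio X F n → 1 ≤ n → 1 ≤ F * n
positive-denominator near 1≤n = *-mono-≤ (NearRatio-F-positive near) 1≤n

-- Sizes from which a lies below, resp. b above, every near ratio: for
-- a = P/Q this is n > 5P, for b = P/Q it is n > 3Q(5P + Q).
lowerThreshold : ℚᵘ → ℕ
lowerThreshold (mkℚᵘ (ℤ.+ P) _) = suc (5 * P)
lowerThreshold (mkℚᵘ -[1+ _ ] _) = 1

upperThreshold : ℚᵘ → ℕ
upperThreshold (mkℚᵘ (ℤ.+ P) dm) = suc (3 * suc dm * (5 * P + suc dm))
upperThreshold (mkℚᵘ -[1+ _ ] _) = 0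

below-cut-below-ratio : ∀ {X F n} a → Below1/√5 a → NearRatio X F n → lowerThreshold a ≤ n →
                        a < frac X (F * n)
below-cut-below-ratio (mkℚᵘ -[1+ m ] dm) _ near 1≤n =
  negative-below-frac m dm _ _ (positive-denominator near 1≤n)
below-cut-below-ratio (mkℚᵘ (ℤ.+ P) dm) (inj₁ a<0) _ _ = ⊥-elim (nonnegative-not-negative P dm a<0)
below-cut-below-ratio (mkℚᵘ (ℤ.+ P) dm) (inj₂ 5a²<1) near 5P<n =
  frac-above P dm _ _ (positive-denominator near (≤-trans (s≤s z≤n) 5P<n))
    (below-ratio {P = P} {Q = suc dm} near (below-cut-square P dm 5a²<1) 5P<n)

above-cut-above-ratio : ∀ {X F n} b → Above1/√5 b → NearRatio X F n → upperThreshold b ≤ n →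
                        frac X (F * n) < b
above-cut-above-ratio (mkℚᵘ -[1+ m ] dm) (0<b , _) _ _ = ⊥-elim (negative-not-positive m dm 0<b)
above-cut-above-ratio (mkℚᵘ (ℤ.+ P) dm) (_ , 1<5b²) near K<n =
  frac-below P dm _ _ (positive-denominator near (≤-trans (s≤s z≤n) K<n))
    (above-ratio {P = P} {Q = suc dm} near (above-cut-square P dm 1<5b²) K<n)

mainTheorem3 : (enum : ℕ → List Tree)
    → (∀ n t → (t ∈ enum n) ⇔ (IsElena t × size t ≡ n))
    → (∀ n → Unique (enum n))
    → ∀ (a b : ℚᵘ) → Below1/√5 a → Above1/√5 b
    → ∃ λ N → ∀ n → n ≥ N
      → (a < expectedLeavesOverN (enum n) n) × (expectedLeavesOverN (enum n) n < b)
mainTheorem3 enum spec unique a b below above = N , bounds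
  where
  n₁ n₂ N : ℕ
  n₁ = lowerThreshold a
  n₂ = upperThreshold b
  N = 3 ⊔ (n₁ ⊔ n₂)
  bounds : ∀ n → n ≥ N → (a < expectedLeavesOverN (enum n) n) × (expectedLeavesOverN (enum n) n < b)
  bounds n N≤n rewrite expected≡ratio enum spec unique n =
      below-cut-below-ratio a below near (≤-trans (≤-trans (m≤m⊔n n₁ n₂) (m≤n⊔m 3 (n₁ ⊔ n₂))) N≤n)
    , above-cut-above-ratio b above near (≤-trans (≤-trans (m≤n⊔m n₁ n₂) (m≤n⊔m 3 (n₁ ⊔ n₂))) N≤n)
    where
    near : NearRatio (ΛE n) (#E n) n
    near = elenas-nearRatio n (≤-trans (m≤m⊔n 3 (n₁ ⊔ n₂)) N≤n)
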